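{- Let $k\ge1$ and $d\ge0$ be integers, and suppose the edge set of the complete graph $K_{2^k}$ on $2^k$ vertices is partitioned into bipartite graphs $G_1,G_2,\dots,G_{k+d}$ (i.e. the $G_i$ are bipartite subgraphs with pairwise disjoint edge sets whose union is $E(K_{2^k})$). Then there exist at least $k$ graphs among $G_1,\dots,G_{k+d}$ each of which contains a matching with at least $\frac{2^{k-2}}{d+1}$ edges.
   Context: A matching is a set of pairwise vertex-disjoint edges. -}

module Defs where

open import Data.Nat using (ℕ; _≤_; _*_; _^_; _+_)
open import Data.Fin using (Fin)
open import Data.Bool using (Bool)
open import Data.Product using (Σ; _×_; proj₁; proj₂; ∃)
open import Relation.Binary.PropositionalEquality using (_≡_; _≢_)
open import Function.Definitions using (Injective)

-- A partition of E(K_n) into r graphs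
-- G_0,…,G_{r-1} is given by an edge colouring: the edge {u,v} (u ≢ v)
-- lies in G_(c u v).  Symmetry makes c a function of the unordered pair.
record EdgePartition (n r : ℕ) : Set where
  field
    colour : Fin n → Fin n → Fin r
    symmetric : ∀ u v → u ≢ v → colour u v ≡ colour v u
open EdgePartition public

InG : ∀ {n r} → EdgePartition n r → Fin r → Fin n → Fin n → Set
InG P i u v = u ≢ v × colour P u v ≡ i

IsBipartite : ∀ {n r} → EdgePartition n r → Fin r → Set
IsBipartite {n} P i = Σ (Fin n → Bool) λ side →
  ∀ u v → InG P i u v → side u ≢ side v

record Matching {n r : ℕ} (P : EdgePartition n r) (i : Fin r) (m : ℕ) : Set where
  field
    edge : Fin m → Fin n × Fin n
    inG : ∀ j → InG P i (proj₁ (edge j)) (proj₂ (edge j))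
    disjoint : ∀ j j' → j ≢ j' →
      (proj₁ (edge j) ≢ proj₁ (edge j')) ×
      (proj₁ (edge j) ≢ proj₂ (edge j')) ×
      (proj₂ (edge j) ≢ proj₁ (edge j')) ×
      (proj₂ (edge j) ≢ proj₂ (edge j'))

-- G_i contains a matching with at least 2^(k-2)/(d+1) edges,
-- i.e. with m edges where m ≥ 2^k / (4 (d+1)), i.e. 2^k ≤ 4 * m * (d+1).
HasLargeMatching : ∀ {n r} → EdgePartition n r → ℕ → ℕ → Fin r → Set
HasLargeMatching P k d i =
  Σ ℕ λ m → (2 ^ k ≤ 4 * m * (d + 1)) × Matching P i m

-- Choose t with 4(d+1)t < 2^k ≤ 4(d+1)(t+1).  Growing a matching greedily in
-- G_i ends either with t+1 edges or with a maximal matching of at most t edges,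
-- whose at most 2t endpoints cover G_i.  If fewer than k of the graphs had
-- t+1 independent edges, take d+1 of the others: the union U of their covers
-- has at most 2t(d+1) < 2^(k-1) vertices.  Any two vertices outside U are
-- joined by an edge of one of the remaining k-1 bipartite graphs, so the k-1
-- two-colourings of these graphs tell them apart, and at most 2^(k-1) vertices
-- lie outside U; together fewer than 2^k vertices, a contradiction.
module Submission where

open import Defs
open import Data.Nat using (ℕ; _≤_; _+_; _^_; suc)
open import Data.Fin using (Fin)
open import Data.Product using (Σ; _×_)
open import Function.Definitions using (Injective)
open import Relation.Binary.PropositionalEquality using (_≡_)

open import Data.Bool using (Bool; true; false)
open import Data.Bool.Properties using (¬-not)
open import Data.Empty using (⊥-elim)
open import Data.Fin using (zero; suc; _≟_; lift)
open import Data.Fin.Properties using (any?; lift-injective; suc-injective)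
open import Data.Fin.Subset
  using (Subset; inside; outside; _∈_; _∉_; _⊆_; _∪_; _∩_; ∁; ⊥; ⁅_⁆; ∣_∣)
open import Data.Fin.Subset.Properties
  using ( _∈?_; nonempty?; Empty-unique; ∉⊥; ∣⊥∣≡0; x∈⁅x⁆; ∣⁅x⁆∣≡1; ∣p∣≤n
        ; p⊆q⇒∣p∣≤∣q∣; p⊆p∪q; q⊆p∪q; p∩q⊆p; x∈p∩q⁻
        ; x∈∁p⇒x∉p; x∉p⇒x∈∁p; ∣∁p∣≡n∸∣p∣ )
open import Data.Nat using (zero; _*_; _∸_; _<_; pred; NonZero; s≤s; z≤n)
open import Data.Nat.DivMod using (_/_; _%_; m/n*n≤m; m≡m%n+[m/n]*n; m%n<n)
open import Data.Nat.Properties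
  using ( ≤-reflexive; ≤-trans; ≤-<-trans; ≤-pred; <⇒≱; n≤1+n; m≤n+m
        ; +-mono-≤; +-monoˡ-≤; +-monoʳ-≤; *-monoʳ-≤; +-suc; *-suc; +-identityʳ
        ; +-cancelʳ-≤; m+[n∸m]≡n; m+n∸n≡m; suc-pred; m^n≢0; module ≤-Reasoning )
open import Data.Nat.Tactic.RingSolver using (solve-∀)
open import Data.Product using (_,_; proj₁; proj₂; ∃)
import Data.Product as Product
open import Data.Sum using (_⊎_; inj₁; inj₂; [_,_]; map₂)
import Data.Sum as Sum
open import Data.Vec using ([]; _∷_; tabulate; here; there)
open import Data.Vec.Properties using ([]=⇒lookup; lookup⇒[]=; lookup∘tabulate)
open import Function using (_∘_; case_of_)
open import Relation.Binary.PropositionalEquality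
  using (_≢_; refl; sym; trans; cong; cong₂; subst; ≢-sym)
open import Relation.Nullary using (¬_; Dec; yes; no; ¬?)
open import Relation.Nullary.Decidable using (_×-dec_; decidable-stable)

private
  variable
    m n r : ℕ

∣p∪q∣≤∣p∣+∣q∣ : (p q : Subset n) → ∣ p ∪ q ∣ ≤ ∣ p ∣ + ∣ q ∣
∣p∪q∣≤∣p∣+∣q∣ []            []            = z≤n
∣p∪q∣≤∣p∣+∣q∣ (inside  ∷ p) (inside  ∷ q) =
  s≤s (≤-trans (∣p∪q∣≤∣p∣+∣q∣ p q) (+-monoʳ-≤ ∣ p ∣ (n≤1+n ∣ q ∣)))
∣p∪q∣≤∣p∣+∣q∣ (inside  ∷ p) (outside ∷ q) = s≤s (∣p∪q∣≤∣p∣+∣q∣ p q)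
∣p∪q∣≤∣p∣+∣q∣ (outside ∷ p) (inside  ∷ q) =
  ≤-trans (s≤s (∣p∪q∣≤∣p∣+∣q∣ p q)) (≤-reflexive (sym (+-suc ∣ p ∣ ∣ q ∣)))
∣p∪q∣≤∣p∣+∣q∣ (outside ∷ p) (outside ∷ q) = ∣p∪q∣≤∣p∣+∣q∣ p q

∣p∣≡∣p∩q∣+∣p∩∁q∣ : (p q : Subset n) → ∣ p ∣ ≡ ∣ p ∩ q ∣ + ∣ p ∩ ∁ q ∣
∣p∣≡∣p∩q∣+∣p∩∁q∣ []            []            = refl
∣p∣≡∣p∩q∣+∣p∩∁q∣ (inside  ∷ p) (inside  ∷ q) = cong suc (∣p∣≡∣p∩q∣+∣p∩∁q∣ p q)
∣p∣≡∣p∩q∣+∣p∩∁q∣ (inside  ∷ p) (outside ∷ q) =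
  trans (cong suc (∣p∣≡∣p∩q∣+∣p∩∁q∣ p q)) (sym (+-suc _ _))
∣p∣≡∣p∩q∣+∣p∩∁q∣ (outside ∷ p) (_       ∷ q) = ∣p∣≡∣p∩q∣+∣p∩∁q∣ p q

∣p∣+∣∁p∣≡n : (p : Subset n) → ∣ p ∣ + ∣ ∁ p ∣ ≡ n
∣p∣+∣∁p∣≡n p = trans (cong (∣ p ∣ +_) (∣∁p∣≡n∸∣p∣ p)) (m+[n∸m]≡n (∣p∣≤n p))

∣p∣≤1 : (p : Subset n) → (∀ {x y} → x ∈ p → y ∈ p → x ≡ y) → ∣ p ∣ ≤ 1
∣p∣≤1 {n} p unique with nonempty? p
... | yes (x , x∈p) = ≤-trans (p⊆q⇒∣p∣≤∣q∣ p⊆⁅x⁆) (≤-reflexive (∣⁅x⁆∣≡1 x))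
  where
  p⊆⁅x⁆ : p ⊆ ⁅ x ⁆
  p⊆⁅x⁆ y∈p = subst (_∈ ⁅ x ⁆) (unique x∈p y∈p) (x∈⁅x⁆ x)
... | no empty = ≤-trans (≤-reflexive (trans (cong ∣_∣ (Empty-unique empty)) (∣⊥∣≡0 n))) z≤n

∈-tabulate⁻ : {f : Fin n → Bool} {x : Fin n} → x ∈ tabulate f → f x ≡ true
∈-tabulate⁻ {f = f} {x} x∈ = trans (sym (lookup∘tabulate f x)) ([]=⇒lookup x∈)

∈-tabulate⁺ : {f : Fin n → Bool} {x : Fin n} → f x ≡ true → x ∈ tabulate f
∈-tabulate⁺ {f = f} {x} fx = lookup⇒[]= x (tabulate f) (trans (lookup∘tabulate f x) fx)

Separates : (Fin r → Fin n → Bool) → Subset r → Subset n → Set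
Separates side S W =
  ∀ {u v} → u ∈ W → v ∈ W → u ≢ v → ∃ λ c → c ∈ S × side c u ≢ side c v

separates-tail : ∀ {side : Fin (suc r) → Fin n → Bool} {s S} {W V : Subset n} →
  Separates side (s ∷ S) W → V ⊆ W →
  (zero ∈ s ∷ S → ∀ {u v} → u ∈ V → v ∈ V → side zero u ≡ side zero v) →
  Separates (side ∘ suc) S V
separates-tail separates V⊆W constant u∈V v∈V u≢v
  with separates (V⊆W u∈V) (V⊆W v∈V) u≢v
... | zero  , zero∈     , differ = ⊥-elim (differ (constant zero∈ u∈V v∈V))
... | suc c , there c∈S , differ = c , c∈S , differ

separated⇒∣W∣≤2^∣S∣ : (side : Fin r → Fin n → Bool) (S : Subset r) (W : Subset n) →
  Separates side S W → ∣ W ∣ ≤ 2 ^ ∣ S ∣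
separated⇒∣W∣≤2^∣S∣ side [] W separates = ∣p∣≤1 W λ u∈W v∈W →
  decidable-stable (_ ≟ _) λ u≢v → case separates u∈W v∈W u≢v of λ { (() , _) }
separated⇒∣W∣≤2^∣S∣ side (outside ∷ S) W separates =
  separated⇒∣W∣≤2^∣S∣ (side ∘ suc) S W (separates-tail separates (λ u∈W → u∈W) λ ())
separated⇒∣W∣≤2^∣S∣ side (inside ∷ S) W separates = begin
  ∣ W ∣                       ≡⟨ ∣p∣≡∣p∩q∣+∣p∩∁q∣ W A ⟩
  ∣ W ∩ A ∣ + ∣ W ∩ ∁ A ∣     ≤⟨ +-mono-≤ (half A both-in) (half (∁ A) both-out) ⟩
  2 ^ ∣ S ∣ + 2 ^ ∣ S ∣       ≡⟨ cong (2 ^ ∣ S ∣ +_) (sym (+-identityʳ _)) ⟩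
  2 ^ suc ∣ S ∣               ∎
  where
  open ≤-Reasoning
  A : Subset _
  A = tabulate (side zero)
  half : ∀ q → (∀ {u v} → u ∈ W ∩ q → v ∈ W ∩ q → side zero u ≡ side zero v) →
    ∣ W ∩ q ∣ ≤ 2 ^ ∣ S ∣
  half q constant =
    separated⇒∣W∣≤2^∣S∣ (side ∘ suc) S (W ∩ q)
      (separates-tail separates (p∩q⊆p W q) λ _ → constant)
  both-in : ∀ {u v} → u ∈ W ∩ A → v ∈ W ∩ A → side zero u ≡ side zero v
  both-in u∈ v∈ =
    trans (∈-tabulate⁻ (proj₂ (x∈p∩q⁻ W A u∈))) (sym (∈-tabulate⁻ (proj₂ (x∈p∩q⁻ W A v∈))))
  outside-A : ∀ {u} → u ∈ W ∩ ∁ A → side zero u ≡ false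
  outside-A u∈ = ¬-not (x∈∁p⇒x∉p (proj₂ (x∈p∩q⁻ W (∁ A) u∈)) ∘ ∈-tabulate⁺)
  both-out : ∀ {u v} → u ∈ W ∩ ∁ A → v ∈ W ∩ ∁ A → side zero u ≡ side zero v
  both-out u∈ v∈ = trans (outside-A u∈) (sym (outside-A v∈))

Covers : (Fin n → Fin n → Set) → Subset n → Set
Covers E C = ∀ {u v} → E u v → u ∈ C ⊎ v ∈ C

covers-⊆ : ∀ {E : Fin n → Fin n → Set} {C D} → C ⊆ D → Covers E C → Covers E D
covers-⊆ C⊆D covers uv = Sum.map C⊆D C⊆D (covers uv)

union-of-covers : ∀ {c} (E : Fin r → Fin n → Fin n → Set) (T : Subset r) →
  (∀ {i} → i ∈ T → ∃ λ C → Covers (E i) C × ∣ C ∣ ≤ c) →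
  ∃ λ U → (∀ {i} → i ∈ T → Covers (E i) U) × ∣ U ∣ ≤ ∣ T ∣ * c
union-of-covers {n = n} E [] _ = ⊥ , (λ ()) , ≤-reflexive (∣⊥∣≡0 n)
union-of-covers E (outside ∷ T) small
  with U , U-covers , ∣U∣≤ ← union-of-covers (E ∘ suc) T (λ i∈T → small (there i∈T))
  = U , (λ { (there i∈T) → U-covers i∈T }) , ∣U∣≤
union-of-covers E (inside ∷ T) small
  with C , C-covers , ∣C∣≤ ← small here
  with U , U-covers , ∣U∣≤ ← union-of-covers (E ∘ suc) T (λ i∈T → small (there i∈T))
  = C ∪ U
  , (λ { here → covers-⊆ (p⊆p∪q U) C-covers
       ; (there i∈T) → covers-⊆ (q⊆p∪q C U) (U-covers i∈T) })
  , ≤-trans (∣p∪q∣≤∣p∣+∣q∣ C U) (+-mono-≤ ∣C∣≤ ∣U∣≤)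

vertex-bound : ∀ {c} (P : EdgePartition n r) → (∀ i → IsBipartite P i) → (T : Subset r) →
  (∀ {i} → i ∈ T → ∃ λ C → Covers (InG P i) C × ∣ C ∣ ≤ c) →
  n ≤ ∣ T ∣ * c + 2 ^ ∣ ∁ T ∣
vertex-bound {n = n} {c = c} P bipartite T small
  with U , U-covers , ∣U∣≤ ← union-of-covers (InG P) T small = begin
  n                          ≡⟨ sym (∣p∣+∣∁p∣≡n U) ⟩
  ∣ U ∣ + ∣ ∁ U ∣            ≤⟨ +-mono-≤ ∣U∣≤ (separated⇒∣W∣≤2^∣S∣ side (∁ T) (∁ U) separated) ⟩
  ∣ T ∣ * c + 2 ^ ∣ ∁ T ∣    ∎
  where
  open ≤-Reasoning
  side : Fin _ → Fin n → Bool
  side i = proj₁ (bipartite i)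
  separated : Separates side (∁ T) (∁ U)
  separated {u} {v} u∈ v∈ u≢v with colour P u v ∈? T
  ... | yes uv∈T = ⊥-elim ([ x∈∁p⇒x∉p u∈ , x∈∁p⇒x∉p v∈ ] (U-covers uv∈T (u≢v , refl)))
  ... | no uv∉T = colour P u v , x∉p⇒x∈∁p uv∉T , proj₂ (bipartite _) u v (u≢v , refl)

endpoints : (Fin m → Fin n × Fin n) → Subset n
endpoints {zero}  e = ⊥
endpoints {suc m} e = ⁅ proj₁ (e zero) ⁆ ∪ ⁅ proj₂ (e zero) ⁆ ∪ endpoints (e ∘ suc)

∣endpoints∣≤2m : (e : Fin m → Fin n × Fin n) → ∣ endpoints e ∣ ≤ 2 * m
∣endpoints∣≤2m {zero}  {n} e = ≤-reflexive (∣⊥∣≡0 n)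
∣endpoints∣≤2m {suc m} e = begin
  ∣ ⁅ x ⁆ ∪ ⁅ y ⁆ ∪ rest ∣              ≤⟨ ∣p∪q∣≤∣p∣+∣q∣ ⁅ x ⁆ _ ⟩
  ∣ ⁅ x ⁆ ∣ + ∣ ⁅ y ⁆ ∪ rest ∣          ≤⟨ +-monoʳ-≤ ∣ ⁅ x ⁆ ∣ (∣p∪q∣≤∣p∣+∣q∣ ⁅ y ⁆ rest) ⟩
  ∣ ⁅ x ⁆ ∣ + (∣ ⁅ y ⁆ ∣ + ∣ rest ∣)
    ≡⟨ cong₂ (λ a b → a + (b + ∣ rest ∣)) (∣⁅x⁆∣≡1 x) (∣⁅x⁆∣≡1 y) ⟩
  2 + ∣ rest ∣                          ≤⟨ +-monoʳ-≤ 2 (∣endpoints∣≤2m (e ∘ suc)) ⟩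
  2 + 2 * m                             ≡⟨ sym (*-suc 2 m) ⟩
  2 * suc m                             ∎
  where
  open ≤-Reasoning
  x = proj₁ (e zero)
  y = proj₂ (e zero)
  rest = endpoints (e ∘ suc)

endpoints-∋ : (e : Fin m → Fin n × Fin n) (j : Fin m) →
  proj₁ (e j) ∈ endpoints e × proj₂ (e j) ∈ endpoints e
endpoints-∋ e zero =
  p⊆p∪q _ (x∈⁅x⁆ _) , q⊆p∪q ⁅ proj₁ (e zero) ⁆ _ (p⊆p∪q _ (x∈⁅x⁆ _))
endpoints-∋ e (suc j) =
  Product.map later later (endpoints-∋ (e ∘ suc) j)
  where
  later : endpoints (e ∘ suc) ⊆ endpoints e
  later = q⊆p∪q ⁅ proj₁ (e zero) ⁆ _ ∘ q⊆p∪q ⁅ proj₂ (e zero) ⁆ _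

Disjoint : Fin n × Fin n → Fin n × Fin n → Set
Disjoint e e′ = (proj₁ e ≢ proj₁ e′) × (proj₁ e ≢ proj₂ e′) ×
                (proj₂ e ≢ proj₁ e′) × (proj₂ e ≢ proj₂ e′)

Disjoint-sym : {e e′ : Fin n × Fin n} → Disjoint e e′ → Disjoint e′ e
Disjoint-sym (a≢x , a≢y , b≢x , b≢y) = ≢-sym a≢x , ≢-sym b≢x , ≢-sym a≢y , ≢-sym b≢y

∉-∈⇒≢ : {p : Subset n} {x y : Fin n} → x ∉ p → y ∈ p → x ≢ y
∉-∈⇒≢ x∉p y∈p refl = x∉p y∈p

module _ (P : EdgePartition n r) (i : Fin r) where

  empty-matching : Matching P i 0
  empty-matching = record { edge = λ () ; inG = λ () ; disjoint = λ () }

  extend : (M : Matching P i m) {u v : Fin n} → InG P i u v →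
    u ∉ endpoints (Matching.edge M) → v ∉ endpoints (Matching.edge M) →
    Matching P i (suc m)
  extend {m} M {u} {v} uv u∉ v∉ =
    record { edge = edge′ ; inG = inG′ ; disjoint = disjoint′ }
    where
    open Matching M
    edge′ : Fin (suc m) → Fin n × Fin n
    edge′ zero    = u , v
    edge′ (suc j) = edge j
    inG′ : ∀ j → InG P i (proj₁ (edge′ j)) (proj₂ (edge′ j))
    inG′ zero    = uv
    inG′ (suc j) = inG j
    fresh : ∀ j → Disjoint (u , v) (edge j)
    fresh j with x∈ , y∈ ← endpoints-∋ edge j =
      ∉-∈⇒≢ u∉ x∈ , ∉-∈⇒≢ u∉ y∈ , ∉-∈⇒≢ v∉ x∈ , ∉-∈⇒≢ v∉ y∈
    disjoint′ : ∀ j j′ → j ≢ j′ → Disjoint (edge′ j) (edge′ j′)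
    disjoint′ zero    zero     j≢j′ = ⊥-elim (j≢j′ refl)
    disjoint′ zero    (suc j′) _    = fresh j′
    disjoint′ (suc j) zero     _    = Disjoint-sym (fresh j)
    disjoint′ (suc j) (suc j′) j≢j′ = disjoint j j′ (j≢j′ ∘ cong suc)

  FreshEdge : Subset n → Set
  FreshEdge E = ∃ λ u → ∃ λ v → InG P i u v × u ∉ E × v ∉ E

  fresh-edge? : (E : Subset n) → Dec (FreshEdge E)
  fresh-edge? E = any? λ u → any? λ v →
    (¬? (u ≟ v) ×-dec (colour P u v ≟ i)) ×-dec (¬? (u ∈? E) ×-dec ¬? (v ∈? E))

  ¬fresh-edge⇒covers : (E : Subset n) → ¬ FreshEdge E → Covers (InG P i) E
  ¬fresh-edge⇒covers E no-fresh-edge {u} {v} uv with u ∈? E | v ∈? E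
  ... | yes u∈ | _      = inj₁ u∈
  ... | no _   | yes v∈ = inj₂ v∈
  ... | no u∉  | no v∉  = ⊥-elim (no-fresh-edge (u , v , uv , u∉ , v∉))

  grow : (M : Matching P i m) →
    Matching P i (suc m) ⊎ Covers (InG P i) (endpoints (Matching.edge M))
  grow M with fresh-edge? (endpoints (Matching.edge M))
  ... | yes (u , v , uv , u∉ , v∉) = inj₁ (extend M uv u∉ v∉)
  ... | no no-fresh-edge = inj₂ (¬fresh-edge⇒covers _ no-fresh-edge)

matching-or-cover : (P : EdgePartition n r) (t : ℕ) (i : Fin r) →
  Matching P i (suc t) ⊎ ∃ λ C → Covers (InG P i) C × ∣ C ∣ ≤ 2 * t
matching-or-cover {n} P zero i =
  map₂ (λ (covers : Covers (InG P i) ⊥) → ⊥ , covers , ≤-reflexive (∣⊥∣≡0 n))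
       (grow P i (empty-matching P i))
matching-or-cover P (suc t) i with matching-or-cover P t i
... | inj₁ M = map₂ (λ (covers : Covers (InG P i) (endpoints (Matching.edge M))) →
                 _ , covers , ∣endpoints∣≤2m (Matching.edge M))
               (grow P i M)
... | inj₂ (C , covers , ∣C∣≤2t) =
  inj₂ (C , covers , ≤-trans ∣C∣≤2t (*-monoʳ-≤ 2 (n≤1+n t)))

pigeonhole-⊎ : {A B : Fin r → Set} → (∀ i → A i ⊎ B i) → ∀ k m → k + m ≤ suc r →
  (Σ (Fin k → Fin r) λ f → Injective _≡_ _≡_ f × ∀ j → A (f j)) ⊎
  (∃ λ T → ∣ T ∣ ≡ m × ∀ {i} → i ∈ T → B i)
pigeonhole-⊎ ab zero m _ = inj₁ ((λ ()) , (λ { {()} }) , (λ ()))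
pigeonhole-⊎ {r} ab (suc k) zero _ = inj₂ (⊥ , ∣⊥∣≡0 r , λ i∈⊥ → ⊥-elim (∉⊥ i∈⊥))
pigeonhole-⊎ {zero} ab (suc k) (suc m) (s≤s k+1+m≤0) =
  case ≤-trans (m≤n+m (suc m) k) k+1+m≤0 of λ ()
pigeonhole-⊎ {suc r} ab (suc k) (suc m) k+m≤ with ab zero
... | inj₁ a with pigeonhole-⊎ (ab ∘ suc) k (suc m) (≤-pred k+m≤)
...   | inj₁ (f , f-injective , fA) =
  inj₁ (lift 1 f , lift-injective f f-injective 1 , λ { zero → a ; (suc j) → fA j })
...   | inj₂ (T , ∣T∣≡m , TB) =
  inj₂ (outside ∷ T , ∣T∣≡m , λ { (there i∈T) → TB i∈T })
pigeonhole-⊎ {suc r} ab (suc k) (suc m) k+m≤ | inj₂ b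
  with pigeonhole-⊎ (ab ∘ suc) (suc k) m (subst (_≤ suc r) (+-suc k m) (≤-pred k+m≤))
...   | inj₁ (f , f-injective , fA) = inj₁ (suc ∘ f , f-injective ∘ suc-injective , fA)
...   | inj₂ (T , ∣T∣≡m , TB) =
  inj₂ (inside ∷ T , cong suc ∣T∣≡m , λ { here → b ; (there i∈T) → TB i∈T })

between-multiples : ∀ N B .{{_ : NonZero N}} .{{_ : NonZero B}} →
  ∃ λ t → t * B < N × N ≤ suc t * B
between-multiples N B = pred N / B , tB<N , N≤[1+t]B
  where
  open ≤-Reasoning
  tB<N : pred N / B * B < N
  tB<N = ≤-<-trans (m/n*n≤m (pred N) B) (≤-reflexive (suc-pred N))
  N≤[1+t]B : N ≤ suc (pred N / B) * B
  N≤[1+t]B = begin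
    N                                      ≡⟨ sym (suc-pred N) ⟩
    suc (pred N)                           ≡⟨ cong suc (m≡m%n+[m/n]*n (pred N) B) ⟩
    suc (pred N % B + pred N / B * B)      ≤⟨ +-monoˡ-≤ (pred N / B * B) (m%n<n (pred N) B) ⟩
    B + pred N / B * B                     ∎

2^[1+k]≤4t[d+1] : ∀ k d t → 2 ^ suc k ≤ suc d * (2 * t) + 2 ^ k → 2 ^ suc k ≤ t * (4 * suc d)
2^[1+k]≤4t[d+1] k d t bound = begin
  2 * 2 ^ k                ≤⟨ *-monoʳ-≤ 2 2^k≤ ⟩
  2 * (suc d * (2 * t))    ≡⟨ regroup d t ⟩
  t * (4 * suc d)          ∎
  where
  open ≤-Reasoning
  regroup : ∀ d t → 2 * (suc d * (2 * t)) ≡ t * (4 * suc d)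
  regroup = solve-∀
  2^k≤ : 2 ^ k ≤ suc d * (2 * t)
  2^k≤ = +-cancelʳ-≤ (2 ^ k) _ _
    (≤-trans (≤-reflexive (cong (2 ^ k +_) (sym (+-identityʳ (2 ^ k))))) bound)

mainTheorem8 : (k d : ℕ) → 1 ≤ k →
    (P : EdgePartition (2 ^ k) (k + d)) →
    (∀ i → IsBipartite P i) →
    Σ (Fin k → Fin (k + d)) λ f →
      Injective _≡_ _≡_ f × (∀ j → HasLargeMatching P k d (f j))
mainTheorem8 zero d ()
mainTheorem8 (suc k) d _ P bipartite
  with t , tB<N , N≤[1+t]B ← between-multiples (2 ^ suc k) (4 * suc d) {{m^n≢0 2 (suc k)}}
  with pigeonhole-⊎ (matching-or-cover P t) (suc k) (suc d) (≤-reflexive (+-suc (suc k) d))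
... | inj₁ (f , f-injective , large) =
  f , f-injective , λ j → suc t , ≤-trans N≤[1+t]B (≤-reflexive (regroup t d)) , large j
  where
  regroup : ∀ t d → suc t * (4 * suc d) ≡ 4 * suc t * (d + 1)
  regroup = solve-∀
... | inj₂ (T , ∣T∣≡1+d , small) =
  ⊥-elim (<⇒≱ tB<N (2^[1+k]≤4t[d+1] k d t (≤-trans (vertex-bound P bipartite T small)
    (≤-reflexive (cong₂ (λ a b → a * (2 * t) + 2 ^ b) ∣T∣≡1+d ∣∁T∣≡k)))))
  where
  ∣∁T∣≡k : ∣ ∁ T ∣ ≡ k
  ∣∁T∣≡k = trans (∣∁p∣≡n∸∣p∣ T) (trans (cong (suc k + d ∸_) ∣T∣≡1+d) (m+n∸n≡m k d))
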